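{- Let $m$ be a positive integer and $a,b$ complex numbers. Consider lattice paths from $(0,0)$ to $(n,0)$ never going below the $x$-axis, with steps $H=(1,0)$, $U=(1,1)$ and $D=(m-1,-1)$. Give a path the weight equal to the product of the weights of its steps, where $U$ has weight $1$, $H$ has weight $a$ and $D$ has weight $b$, and let $c(n,m,a,b)$ be the sum of the weights of all such paths from $(0,0)$ to $(n,0)$. Then $f_m(z,a,b)=\sum_{n\ge0}c(n,m,a,b)z^n$ satisfies $$f_m(z,a,b)=1+azf_m(z,a,b)+bz^mf_m(z,a,b)^2,$$ and $$c(n,m,a,b)=\sum_{k=0}^{\lfloor n/m\rfloor}\binom{2k}{k}\frac{1}{k+1}\binom{n+(2-m)k}{2k}a^{n-mk}b^k.$$ -}

module Defs where

open import Level using (Level)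
open import Algebra.Bundles using (CommutativeRing)
open import Data.Nat as ℕ using (ℕ; zero; suc; NonZero; _∸_; _≡ᵇ_)
open import Data.Nat.Combinatorics using (_C_)
open import Data.Bool using (Bool; true; false; _∧_)
open import Data.List using (List; []; _∷_; map; concatMap; upTo; foldr)

data Step : Set where
  H U D : Step

dx : ℕ → Step → ℕ
dx m H = 1
dx m U = 1
dx m D = m ∸ 1

xlen : ℕ → List Step → ℕ
xlen m []      = 0
xlen m (s ∷ p) = dx m s ℕ.+ xlen m p

validFrom : ℕ → List Step → Bool
validFrom zero    []      = true
validFrom (suc h) []      = false
validFrom h       (H ∷ p) = validFrom h p
validFrom h       (U ∷ p) = validFrom (suc h) p
validFrom zero    (D ∷ p) = false
validFrom (suc h) (D ∷ p) = validFrom h p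

words : ℕ → List (List Step)
words zero    = [] ∷ []
words (suc L) = concatMap (λ s → map (s ∷_) (words L)) (H ∷ U ∷ D ∷ [])

wordsUpTo : ℕ → List (List Step)
wordsUpTo L = concatMap words (upTo (suc L))

filterB : {A : Set} → (A → Bool) → List A → List A
filterB P []       = []
filterB P (x ∷ xs) with P x
... | true  = x ∷ filterB P xs
... | false = filterB P xs

-- Every such path has h H-steps, k U-steps, k D-steps with h + m k = n,
-- hence length h + 2k ≤ 2n (as m ≥ 1); so enumerating words of length ≤ 2n
-- lists every such path exactly once.
paths : ℕ → ℕ → List (List Step)
paths m n = filterB (λ p → validFrom 0 p ∧ (xlen m p ≡ᵇ n)) (wordsUpTo (2 ℕ.* n))

-- Catalan number  binom(2k,k) / (k+1)  (exact division)
catalan : ℕ → ℕ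
catalan k = ((2 ℕ.* k) C k) ℕ./ suc k

module _ {c ℓ : Level} (R : CommutativeRing c ℓ) where
  open CommutativeRing R

  fromℕ : ℕ → Carrier
  fromℕ zero    = 0#
  fromℕ (suc n) = 1# + fromℕ n

  pow : Carrier → ℕ → Carrier
  pow x zero    = 1#
  pow x (suc k) = x * pow x k

  ringSum : List Carrier → Carrier
  ringSum = foldr _+_ 0#

  stepWeight : Carrier → Carrier → Step → Carrier
  stepWeight a b H = a
  stepWeight a b U = 1#
  stepWeight a b D = b

  pathWeight : Carrier → Carrier → List Step → Carrier
  pathWeight a b []      = 1#
  pathWeight a b (s ∷ p) = stepWeight a b s * pathWeight a b p

  cnm : ℕ → ℕ → Carrier → Carrier → Carrier
  cnm n m a b = ringSum (map (pathWeight a b) (paths m n))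

  Series : Set c
  Series = ℕ → Carrier

  oneS : Series
  oneS zero    = 1#
  oneS (suc n) = 0#

  _+S_ : Series → Series → Series
  (f +S g) n = f n + g n

  _·S_ : Carrier → Series → Series
  (a ·S f) n = a * f n

  _*S_ : Series → Series → Series
  (f *S g) n = ringSum (map (λ i → f i * g (n ∸ i)) (upTo (suc n)))

  zPow : ℕ → Series → Series
  zPow k f n with n ℕ.<ᵇ k
  ... | true  = 0#
  ... | false = f (n ∸ k)

  fm : ℕ → Carrier → Carrier → Series
  fm m a b n = cnm n m a b

  closedForm : (n m : ℕ) → .{{NonZero m}} → Carrier → Carrier → Carrier
  closedForm n m a b =
    ringSum (map (λ k → fromℕ (catalan k ℕ.* ((n ∸ m ℕ.* k ℕ.+ 2 ℕ.* k) C (2 ℕ.* k)))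
                          * (pow a (n ∸ m ℕ.* k) * pow b k))
                 (upTo (suc (n ℕ./ m))))

module Submission where

open import Defs
open import Level using (Level)
open import Algebra.Bundles using (CommutativeRing)
open import Data.Nat using (ℕ; NonZero)
open import Data.Product using (_×_)

-- We rewrite c(n) as Σ_{L ≤ 2n} S L (contrib n), where S L sums over all
-- sequences of length L, and note that any longer range of lengths gives the
-- same value, since a path of extent n has length at most 2n (c-stable).
--
-- Functional equation: classify paths by their first step.  An H-step leaves
-- a·c(n-1); no path starts with D; a path U w factors at its first return to
-- the axis as U u D v (first-return), which gives b·Σ_j c(j)·c(n-m-j).
--
-- Closed formula: a path with i H-steps and k U-steps has k D-steps, length
-- i + 2k, extent i + m k and weight a^i b^k; there are C(i+2k, i)·ballot k 0 of
-- them (pathCount, S-by-type), and ballot k 0 is the Catalan number by the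
-- reflection principle.  Summing over lengths, then i, then k gives the formula.

module Binomials where
  open import Data.Nat
  open import Data.Nat.Properties
  open import Data.Nat.Combinatorics
  open import Data.Nat.DivMod using (m*n/n≡m)
  open import Data.Nat.Tactic.RingSolver using (solve-∀)
  open import Data.Bool using (true; false; if_then_else_; T)
  open import Relation.Binary.PropositionalEquality
  open ≡-Reasoning

  pascal : ∀ n k → suc n C suc k ≡ n C k + n C suc k
  pascal n k = sym (nCk+nC[k+1]≡[n+1]C[k+1] n k)

  absorption : ∀ n k → suc k * (suc n C suc k) ≡ suc n * (n C k)
  absorption zero    zero    = refl
  absorption zero    (suc k) = *-zeroʳ (suc (suc k))
  absorption (suc n) zero    = trans (+-identityʳ _) (trans (nC1≡n (suc (suc n))) (sym (*-identityʳ _)))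
  absorption (suc n) (suc k) = begin
    suc (suc k) * (suc (suc n) C suc (suc k))           ≡⟨ cong (suc (suc k) *_) (pascal (suc n) (suc k)) ⟩
    suc (suc k) * (X + suc n C suc (suc k))             ≡⟨ *-distribˡ-+ (suc (suc k)) X _ ⟩
    (X + suc k * X) + suc (suc k) * (suc n C suc (suc k))
                                                        ≡⟨ cong₂ (λ p q → (X + p) + q) (absorption n k) (absorption n (suc k)) ⟩
    (X + suc n * (n C k)) + suc n * (n C suc k)         ≡⟨ +-assoc X _ _ ⟩
    X + (suc n * (n C k) + suc n * (n C suc k))         ≡⟨ cong (X +_) (*-distribˡ-+ (suc n) (n C k) _) ⟨
    X + suc n * (n C k + n C suc k)                     ≡⟨ cong (λ p → X + suc n * p) (pascal n k) ⟨
    suc (suc n) * X                                     ∎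
    where X = suc n C suc k

  central-neighbour : ∀ k → suc k * ((2 * k) C suc k) ≡ k * ((2 * k) C k)
  central-neighbour zero    = refl
  central-neighbour (suc k) = begin
    suc (suc k) * (2 * suc k C suc (suc k))   ≡⟨ cong (λ n → suc (suc k) * (n C suc (suc k))) two-suc ⟩
    suc (suc k) * (suc n C suc (suc k))       ≡⟨ absorption n (suc k) ⟩
    suc n * (n C suc k)                       ≡⟨ cong (suc n *_) symmetric ⟨
    suc n * (n C k)                           ≡⟨ absorption n k ⟨
    suc k * (suc n C suc k)                   ≡⟨ cong (λ n → suc k * (n C suc k)) two-suc ⟨
    suc k * (2 * suc k C suc k)               ∎
    where
    n = suc (2 * k)
    two-suc : 2 * suc k ≡ suc n
    two-suc = cong suc (+-suc k (k + 0))
    symmetric : n C k ≡ n C suc k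
    symmetric = begin
      n C k             ≡⟨ nCk≡nC[n∸k] (≤-trans (m≤m+n k (k + 0)) (n≤1+n _)) ⟩
      n C (n ∸ k)       ≡⟨ cong (λ j → n C (suc k + j ∸ k)) (+-identityʳ k) ⟩
      n C (suc k + k ∸ k) ≡⟨ cong (n C_) (m+n∸n≡m (suc k) k) ⟩
      n C suc k         ∎

  -- ballot k h counts the sequences of k up-steps and k+h down-steps that,
  -- started at height h, never go below 0 (they end at height 0).
  -- The recursion is on the first step.
  ballot : ℕ → ℕ → ℕ
  ballot zero    h       = 1
  ballot (suc k) zero    = ballot k 1
  ballot (suc k) (suc h) = ballot k (suc (suc h)) + ballot (suc k) h

  private
    length-up : ∀ k h → 2 * suc k + h ≡ suc (2 * k + suc h)
    length-up = solve-∀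

    length-down : ∀ k h → 2 * suc k + h ≡ 2 * k + suc (suc h)
    length-down = solve-∀

    regroup : ∀ x y z w → (x + y) + (z + w) ≡ (x + w) + (y + z)
    regroup = solve-∀

    regroup₃ : ∀ x y z → x + (y + z) ≡ (x + z) + y
    regroup₃ = solve-∀

  -- The reflection principle: the bad sequences (those touching -1) are
  -- counted by C(2k+h, k+h+1), so  ballot k h = C(2k+h, k) - C(2k+h, k+h+1).
  ballot-reflection : ∀ k h → ballot k h + (2 * k + h) C (suc k + h) ≡ (2 * k + h) C k
  ballot-reflection zero    h       = cong suc (k>n⇒nCk≡0 (n<1+n h))
  ballot-reflection (suc k) zero    = begin
    ballot k 1 + (2 * suc k + 0) C (2 + k + 0)   ≡⟨ cong₂ (λ n j → ballot k 1 + n C suc (suc j)) (length-up k 0) (+-identityʳ k) ⟩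
    ballot k 1 + suc n C (2 + k)                 ≡⟨ cong (ballot k 1 +_) (pascal n (suc k)) ⟩
    ballot k 1 + (n C suc k + n C (2 + k))       ≡⟨ regroup₃ (ballot k 1) _ _ ⟩
    (ballot k 1 + n C (2 + k)) + n C suc k       ≡⟨ cong (λ j → (ballot k 1 + n C suc j) + n C suc k) (+-comm 1 k) ⟩
    (ballot k 1 + n C (suc k + 1)) + n C suc k   ≡⟨ cong (_+ n C suc k) (ballot-reflection k 1) ⟩
    n C k + n C suc k                            ≡⟨ pascal n k ⟨
    suc n C suc k                                ≡⟨ cong (_C suc k) (length-up k 0) ⟨
    (2 * suc k + 0) C suc k                      ∎
    where n = 2 * k + 1
  ballot-reflection (suc k) (suc h) = begin
    (B₁ + B₂) + (2 * suc k + suc h) C (suc (suc k) + suc h)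
      ≡⟨ cong (λ n → (B₁ + B₂) + n C (suc (suc k) + suc h)) (length-up k (suc h)) ⟩
    (B₁ + B₂) + suc n C suc (suc k + suc h)
      ≡⟨ cong ((B₁ + B₂) +_) (pascal n _) ⟩
    (B₁ + B₂) + (n C (suc k + suc h) + n C suc (suc k + suc h))
      ≡⟨ regroup B₁ B₂ _ _ ⟩
    (B₁ + n C suc (suc k + suc h)) + (B₂ + n C (suc k + suc h))
      ≡⟨ cong₂ _+_ (subst (λ j → B₁ + n C suc j ≡ n C k) (+-suc k (suc h))
                          (ballot-reflection k (suc (suc h))))
                   (subst₂ (λ n j → B₂ + n C j ≡ n C suc k) (length-down k h) (sym (+-suc (suc k) h))
                           (ballot-reflection (suc k) h)) ⟩
    n C k + n C suc k
      ≡⟨ pascal n k ⟨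
    suc n C suc k
      ≡⟨ cong (_C suc k) (length-up k (suc h)) ⟨
    (2 * suc k + suc h) C suc k ∎
    where
    n  = 2 * k + suc (suc h)
    B₁ = ballot k (suc (suc h))
    B₂ = ballot (suc k) h

  -- Dyck paths are counted by the Catalan numbers:  C(2k,k) = (k+1)·ballot k 0,
  -- obtained from the reflection principle and central-neighbour.
  catalan≡ballot : ∀ k → catalan k ≡ ballot k 0
  catalan≡ballot k = begin
    ((2 * k) C k) / suc k           ≡⟨ cong (_/ suc k) central≡ ⟩
    (suc k * ballot k 0) / suc k    ≡⟨ cong (_/ suc k) (*-comm (suc k) (ballot k 0)) ⟩
    (ballot k 0 * suc k) / suc k    ≡⟨ m*n/n≡m (ballot k 0) (suc k) ⟩
    ballot k 0                      ∎
    where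
    n = 2 * k
    reflection : ballot k 0 + n C suc k ≡ n C k
    reflection = subst₂ (λ n j → ballot k 0 + n C suc j ≡ n C k) (+-identityʳ n) (+-identityʳ k) (ballot-reflection k 0)
    central≡ : n C k ≡ suc k * ballot k 0
    central≡ = +-cancelʳ-≡ (k * (n C k)) _ _ (begin
      n C k + k * (n C k)                          ≡⟨⟩
      suc k * (n C k)                              ≡⟨ cong (suc k *_) reflection ⟨
      suc k * (ballot k 0 + n C suc k)             ≡⟨ *-distribˡ-+ (suc k) (ballot k 0) _ ⟩
      suc k * ballot k 0 + suc k * (n C suc k)     ≡⟨ cong (suc k * ballot k 0 +_) (central-neighbour k) ⟩
      suc k * ballot k 0 + k * (n C k)             ∎)

  shifted : (ℕ → ℕ) → ℕ → ℕ
  shifted f zero    = 0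
  shifted f (suc x) = f x

  -- pathCount L h i k is the number of step sequences of length L with i H-steps
  -- and k U-steps (hence k + h D-steps) which, started at height h, never go
  -- below 0 and end at 0: the H-steps are placed freely, the rest is a ballot sequence.
  pathCount : ℕ → ℕ → ℕ → ℕ → ℕ
  pathCount L h i k = if i + 2 * k + h ≡ᵇ L then (L C i) * ballot k h else 0

  private
    if-same : ∀ g → (if g then 0 else 0) ≡ 0
    if-same true  = refl
    if-same false = refl

    if-+ : ∀ g x y → (if g then x else 0) + (if g then y else 0) ≡ (if g then x + y else 0)
    if-+ true  x y = refl
    if-+ false x y = refl

    length-U : ∀ i k h → i + 2 * suc k + h ≡ suc (i + 2 * k + suc h)
    length-U = solve-∀

  -- The counting identity behind pathCount-step: for a sequence of length L+1,
  -- Pascal's rule splits off an initial H-step and the ballot recursion an initial U- or D-step.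
  pathCount-step-values : ∀ L i k h → i + 2 * k + h ≡ suc L →
    (suc L C i) * ballot k h ≡ shifted (λ i′ → (L C i′) * ballot k h) i
                             + (shifted (λ k′ → (L C i) * ballot k′ (suc h)) k + shifted (λ h′ → (L C i) * ballot k h′) h)
  pathCount-step-values L zero    zero    zero    ()
  pathCount-step-values L zero    zero    (suc h) _ = refl
  pathCount-step-values L zero    (suc k) zero    _ = sym (+-identityʳ _)
  pathCount-step-values L zero    (suc k) (suc h) _ = *-distribˡ-+ 1 (ballot k (suc (suc h))) _
  pathCount-step-values L (suc i) zero    zero    e = begin
    (suc L C suc i) * 1              ≡⟨ cong (_* 1) (pascal L i) ⟩
    (L C i + L C suc i) * 1          ≡⟨ cong (λ x → (L C i + x) * 1) (k>n⇒nCk≡0 (≤-reflexive (cong suc (sym i≡L)))) ⟩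
    (L C i + 0) * 1                  ≡⟨ cong (_* 1) (+-identityʳ (L C i)) ⟩
    (L C i) * 1                      ≡⟨ +-identityʳ _ ⟨
    (L C i) * 1 + 0                  ∎
    where
    i≡L : i ≡ L
    i≡L = trans (sym (trans (+-identityʳ (i + 0)) (+-identityʳ i))) (suc-injective e)
  pathCount-step-values L (suc i) zero    (suc h) _ = trans (cong (_* 1) (pascal L i)) (*-distribʳ-+ 1 (L C i) _)
  pathCount-step-values L (suc i) (suc k) zero    _ = begin
    (suc L C suc i) * B                   ≡⟨ cong (_* B) (pascal L i) ⟩
    (L C i + L C suc i) * B               ≡⟨ *-distribʳ-+ B (L C i) _ ⟩
    (L C i) * B + (L C suc i) * B         ≡⟨ cong ((L C i) * B +_) (+-identityʳ _) ⟨
    (L C i) * B + ((L C suc i) * B + 0)   ∎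
    where B = ballot k 1
  pathCount-step-values L (suc i) (suc k) (suc h) _ = begin
    (suc L C suc i) * (B₁ + B₂)                           ≡⟨ cong (_* (B₁ + B₂)) (pascal L i) ⟩
    (L C i + L C suc i) * (B₁ + B₂)                       ≡⟨ *-distribʳ-+ (B₁ + B₂) (L C i) _ ⟩
    (L C i) * (B₁ + B₂) + (L C suc i) * (B₁ + B₂)         ≡⟨ cong ((L C i) * (B₁ + B₂) +_) (*-distribˡ-+ (L C suc i) B₁ B₂) ⟩
    (L C i) * (B₁ + B₂) + ((L C suc i) * B₁ + (L C suc i) * B₂) ∎
    where
    B₁ = ballot k (suc (suc h))
    B₂ = ballot (suc k) h

  pathCount-step : ∀ L h i k →
    pathCount (suc L) h i k ≡ shifted (λ i′ → pathCount L h i′ k) i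
                              + (shifted (pathCount L (suc h) i) k + shifted (λ h′ → pathCount L h′ i k) h)
  pathCount-step L h i k = begin
    (if g then (suc L C i) * ballot k h else 0)
      ≡⟨ guarded (pathCount-step-values L i k h) ⟩
    (if g then vH i + (vU k + vD h) else 0)
      ≡⟨ trans (cong ((if g then vH i else 0) +_) (if-+ g _ _)) (if-+ g _ _) ⟨
    (if g then vH i else 0) + ((if g then vU k else 0) + (if g then vD h else 0))
      ≡⟨ cong₂ _+_ (H-step i) (cong₂ _+_ (U-step k) (D-step h)) ⟨
    shifted (λ i′ → pathCount L h i′ k) i + (shifted (pathCount L (suc h) i) k + shifted (λ h′ → pathCount L h′ i k) h) ∎
    where
    g = i + 2 * k + h ≡ᵇ suc L
    vH = shifted (λ i′ → (L C i′) * ballot k h)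
    vU = shifted (λ k′ → (L C i) * ballot k′ (suc h))
    vD = shifted (λ h′ → (L C i) * ballot k h′)
    guarded : ∀ {x y} → (i + 2 * k + h ≡ suc L → x ≡ y) → (if g then x else 0) ≡ (if g then y else 0)
    guarded x≡y with g in eq
    ... | true  = x≡y (≡ᵇ⇒≡ _ _ (subst T (sym eq) _))
    ... | false = refl
    H-step : ∀ i → shifted (λ i′ → pathCount L h i′ k) i ≡ (if i + 2 * k + h ≡ᵇ suc L then vH i else 0)
    H-step zero    = sym (if-same _)
    H-step (suc i) = refl
    U-step : ∀ k → shifted (pathCount L (suc h) i) k ≡ (if i + 2 * k + h ≡ᵇ suc L then vU k else 0)
    U-step zero    = sym (if-same _)
    U-step (suc k) = cong (λ n → if n ≡ᵇ suc L then vU (suc k) else 0) (sym (length-U i k h))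
    D-step : ∀ h → shifted (λ h′ → pathCount L h′ i k) h ≡ (if i + 2 * k + h ≡ᵇ suc L then vD h else 0)
    D-step zero    = sym (if-same _)
    D-step (suc h) = cong (λ n → if n ≡ᵇ suc L then vD (suc h) else 0) (sym (+-suc (i + 2 * k) h))

  dyck-count : ∀ i k → ((i + 2 * k + 0) C i) * ballot k 0 ≡ catalan k * ((i + 2 * k) C (2 * k))
  dyck-count i k = begin
    ((i + 2 * k + 0) C i) * ballot k 0       ≡⟨ cong (λ n → (n C i) * ballot k 0) (+-identityʳ _) ⟩
    ((i + 2 * k) C i) * ballot k 0           ≡⟨ cong (_* ballot k 0) (nCk≡nC[n∸k] (m≤m+n i (2 * k))) ⟩
    ((i + 2 * k) C (i + 2 * k ∸ i)) * ballot k 0 ≡⟨ cong (λ j → ((i + 2 * k) C j) * ballot k 0) (m+n∸m≡n i (2 * k)) ⟩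
    ((i + 2 * k) C (2 * k)) * ballot k 0     ≡⟨ *-comm _ (ballot k 0) ⟩
    ballot k 0 * ((i + 2 * k) C (2 * k))     ≡⟨ cong (_* ((i + 2 * k) C (2 * k))) (catalan≡ballot k) ⟨
    catalan k * ((i + 2 * k) C (2 * k))      ∎

module Sequences where
  open import Data.Nat
  open import Data.Nat.Properties
  open import Data.Nat.Tactic.RingSolver using (solve-∀)
  open import Data.Bool using (T)
  open import Data.List using (List; []; _∷_; _++_; length)
  open import Relation.Binary.PropositionalEquality

  validFrom-H : ∀ h w → validFrom h (H ∷ w) ≡ validFrom h w
  validFrom-H zero    w = refl
  validFrom-H (suc h) w = refl

  validFrom-U : ∀ h w → validFrom h (U ∷ w) ≡ validFrom (suc h) w
  validFrom-U zero    w = refl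
  validFrom-U (suc h) w = refl

  private
    twice-suc : ∀ x h → 2 * suc x + h ≡ suc (suc (2 * x + h))
    twice-suc = solve-∀

  -- A path from height h to the axis has #U up-steps and #U + h down-steps,
  -- so its length is at most twice its horizontal extent plus h.
  length-bound : ∀ m h w → T (validFrom h w) → length w ≤ 2 * xlen m w + h
  length-bound m zero    []      _     = z≤n
  length-bound m h       (H ∷ w) valid = begin
    suc (length w)                ≤⟨ s≤s (length-bound m h w (subst T (validFrom-H h w) valid)) ⟩
    suc (2 * xlen m w + h)        ≤⟨ n≤1+n _ ⟩
    suc (suc (2 * xlen m w + h))  ≡⟨ twice-suc (xlen m w) h ⟨
    2 * suc (xlen m w) + h        ∎
    where open ≤-Reasoning
  length-bound m h       (U ∷ w) valid = begin
    suc (length w)                ≤⟨ s≤s (length-bound m (suc h) w (subst T (validFrom-U h w) valid)) ⟩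
    suc (2 * xlen m w + suc h)    ≡⟨ cong suc (+-suc (2 * xlen m w) h) ⟩
    suc (suc (2 * xlen m w + h))  ≡⟨ twice-suc (xlen m w) h ⟨
    2 * suc (xlen m w) + h        ∎
    where open ≤-Reasoning
  length-bound m (suc h) (D ∷ w) valid = begin
    suc (length w)                ≤⟨ s≤s (length-bound m h w valid) ⟩
    suc (2 * xlen m w + h)        ≡⟨ +-suc (2 * xlen m w) h ⟨
    2 * xlen m w + suc h          ≤⟨ +-monoˡ-≤ (suc h) (*-monoʳ-≤ 2 (m≤n+m (xlen m w) (m ∸ 1))) ⟩
    2 * xlen m (D ∷ w) + suc h    ∎
    where open ≤-Reasoning

  xlen-++ : ∀ m u v → xlen m (u ++ v) ≡ xlen m u + xlen m v
  xlen-++ m []      v = refl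
  xlen-++ m (s ∷ u) v = trans (cong (dx m s +_) (xlen-++ m u v)) (sym (+-assoc (dx m s) _ _))

  #H #U #D : List Step → ℕ
  #H []      = 0
  #H (H ∷ w) = suc (#H w)
  #H (_ ∷ w) = #H w
  #U []      = 0
  #U (U ∷ w) = suc (#U w)
  #U (_ ∷ w) = #U w
  #D []      = 0
  #D (D ∷ w) = suc (#D w)
  #D (_ ∷ w) = #D w

  xlen-by-type : ∀ d w → xlen (suc d) w ≡ #H w + (#U w + d * #D w)
  xlen-by-type d []      = sym (*-zeroʳ d)
  xlen-by-type d (H ∷ w) = cong suc (xlen-by-type d w)
  xlen-by-type d (U ∷ w) = trans (cong suc (xlen-by-type d w)) (sym (+-suc (#H w) _))
  xlen-by-type d (D ∷ w) = trans (cong (d +_) (xlen-by-type d w)) (shuffle d (#H w) (#U w) (#D w))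
    where
    shuffle : ∀ d x y z → d + (x + (y + d * z)) ≡ x + (y + d * suc z)
    shuffle = solve-∀

  short-path : ∀ m n w → T (validFrom 0 w) → xlen m w ≤ n → length w ≤ 2 * n
  short-path m n w valid x≤n =
    ≤-trans (length-bound m 0 w valid) (≤-trans (≤-reflexive (+-identityʳ _)) (*-monoʳ-≤ 2 x≤n))

module RingSums {c ℓ : Level} (R : CommutativeRing c ℓ) where
  import Level
  open import Data.Nat as ℕ using (zero; suc; _≤_; _<_; z≤n; s≤s; _∸_; _≡ᵇ_)
  import Data.Nat.Properties as ℕ
  open import Data.Fin using (toℕ)
  open import Data.Bool using (Bool; true; false; T; _∧_; if_then_else_)
  open import Data.Unit using (tt)
  open import Data.Empty using (⊥-elim)
  open import Data.List using (List; []; _∷_; _++_; map; concatMap; applyUpTo; length)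
  open import Data.List.Properties using (map-∘)
  import Relation.Binary.PropositionalEquality as ≡
  open Sequences using (validFrom-H; validFrom-U; #H; #U; #D)
  open Binomials using (pathCount; pathCount-step; shifted)

  open CommutativeRing R
  open import Algebra.Properties.Semiring.Sum semiring
    using (sum; ∑-distrib-+; ∑-comm; *-distribˡ-sum; *-distribʳ-sum)
  open import Relation.Binary.Reasoning.Setoid setoid

  Σ : ℕ → (ℕ → Carrier) → Carrier
  Σ zero    f = 0#
  Σ (suc n) f = f 0 + Σ n (λ i → f (suc i))

  Σ≡sum : ∀ n (f : ℕ → Carrier) → Σ n f ≡.≡ sum {n} (λ i → f (toℕ i))
  Σ≡sum zero    f = ≡.refl
  Σ≡sum (suc n) f = ≡.cong (f 0 +_) (Σ≡sum n (λ i → f (suc i)))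

  Σ-cong< : ∀ n {f g : ℕ → Carrier} → (∀ {i} → i < n → f i ≈ g i) → Σ n f ≈ Σ n g
  Σ-cong< zero    f≈g = refl
  Σ-cong< (suc n) f≈g = +-cong (f≈g (s≤s z≤n)) (Σ-cong< n (λ i<n → f≈g (s≤s i<n)))

  Σ-cong : ∀ n {f g : ℕ → Carrier} → (∀ i → f i ≈ g i) → Σ n f ≈ Σ n g
  Σ-cong n f≈g = Σ-cong< n (λ {i} _ → f≈g i)

  Σ-zero : ∀ n {f : ℕ → Carrier} → (∀ {i} → i < n → f i ≈ 0#) → Σ n f ≈ 0#
  Σ-zero zero    f≈0 = refl
  Σ-zero (suc n) f≈0 = trans (+-cong (f≈0 (s≤s z≤n)) (Σ-zero n (λ i<n → f≈0 (s≤s i<n)))) (+-identityʳ 0#)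

  Σ-+ : ∀ n (f g : ℕ → Carrier) → Σ n (λ i → f i + g i) ≈ Σ n f + Σ n g
  Σ-+ n f g = begin
    Σ n (λ i → f i + g i)                               ≡⟨ Σ≡sum n _ ⟩
    sum {n} (λ i → f (toℕ i) + g (toℕ i))               ≈⟨ ∑-distrib-+ {n} (λ i → f (toℕ i)) (λ i → g (toℕ i)) ⟩
    sum {n} (λ i → f (toℕ i)) + sum {n} (λ i → g (toℕ i)) ≡⟨ ≡.cong₂ _+_ (Σ≡sum n f) (Σ≡sum n g) ⟨
    Σ n f + Σ n g                                       ∎

  Σ-*ˡ : ∀ n x (f : ℕ → Carrier) → x * Σ n f ≈ Σ n (λ i → x * f i)
  Σ-*ˡ n x f = begin
    x * Σ n f                          ≡⟨ ≡.cong (x *_) (Σ≡sum n f) ⟩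
    x * sum {n} (λ i → f (toℕ i))      ≈⟨ *-distribˡ-sum {n} x (λ i → f (toℕ i)) ⟩
    sum {n} (λ i → x * f (toℕ i))      ≡⟨ Σ≡sum n _ ⟨
    Σ n (λ i → x * f i)                ∎

  Σ-*ʳ : ∀ n x (f : ℕ → Carrier) → Σ n f * x ≈ Σ n (λ i → f i * x)
  Σ-*ʳ n x f = trans (*-comm _ x) (trans (Σ-*ˡ n x f) (Σ-cong n (λ i → *-comm x (f i))))

  Σ-swap : ∀ n k (f : ℕ → ℕ → Carrier) → Σ n (λ i → Σ k (f i)) ≈ Σ k (λ j → Σ n (λ i → f i j))
  Σ-swap n k f = begin
    Σ n (λ i → Σ k (f i))                               ≈⟨ Σ-cong n (λ i → reflexive (Σ≡sum k (f i))) ⟩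
    Σ n (λ i → sum {k} (λ j → f i (toℕ j)))             ≡⟨ Σ≡sum n _ ⟩
    sum {n} (λ i → sum {k} (λ j → f (toℕ i) (toℕ j)))   ≈⟨ ∑-comm {n} {k} (λ i j → f (toℕ i) (toℕ j)) ⟩
    sum {k} (λ j → sum {n} (λ i → f (toℕ i) (toℕ j)))   ≡⟨ Σ≡sum k _ ⟨
    Σ k (λ j → sum {n} (λ i → f (toℕ i) j))             ≈⟨ Σ-cong k (λ j → reflexive (Σ≡sum n (λ i → f i j))) ⟨
    Σ k (λ j → Σ n (λ i → f i j))                       ∎

  Σ-truncate : ∀ n k (f : ℕ → Carrier) → n ≤ k → (∀ {i} → n ≤ i → i < k → f i ≈ 0#) → Σ k f ≈ Σ n f
  Σ-truncate zero    k       f n≤k       f≈0 = Σ-zero k (f≈0 z≤n)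
  Σ-truncate (suc n) (suc k) f (s≤s n≤k) f≈0 =
    +-congˡ (Σ-truncate n k (λ i → f (suc i)) n≤k (λ n≤i i<k → f≈0 (s≤s n≤i) (s≤s i<k)))

  Σ-antidiagonals : ∀ N (G : ℕ → ℕ → Carrier) →
    Σ N (λ L → Σ (suc L) (λ i → G i (L ∸ i))) ≈ Σ N (λ i → Σ (N ∸ i) (G i))
  Σ-antidiagonals zero    G = refl
  Σ-antidiagonals (suc N) G = begin
    (G 0 0 + 0#) + Σ N (λ L → G 0 (suc L) + Σ (suc L) (λ i → G (suc i) (L ∸ i)))
      ≈⟨ +-cong (+-identityʳ _) (Σ-+ N (λ L → G 0 (suc L)) _) ⟩
    G 0 0 + (Σ N (λ L → G 0 (suc L)) + Σ N (λ L → Σ (suc L) (λ i → G (suc i) (L ∸ i))))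
      ≈⟨ +-congˡ (+-congˡ (Σ-antidiagonals N (λ i → G (suc i)))) ⟩
    G 0 0 + (Σ N (λ L → G 0 (suc L)) + Σ N (λ i → Σ (N ∸ i) (G (suc i))))
      ≈⟨ +-assoc _ _ _ ⟨
    Σ (suc N) (λ i → Σ (suc N ∸ i) (G i)) ∎

  Σ-triangle-to-square : ∀ B (G : ℕ → ℕ → Carrier) →
    (∀ {i} j → B ≤ i → G i j ≈ 0#) → (∀ i {j} → B ≤ j → G i j ≈ 0#) →
    Σ (B ℕ.+ B) (λ i → Σ (B ℕ.+ B ∸ i) (G i)) ≈ Σ B (λ i → Σ B (G i))
  Σ-triangle-to-square B G row≈0 column≈0 = begin
    Σ (B ℕ.+ B) (λ i → Σ (B ℕ.+ B ∸ i) (G i))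
      ≈⟨ Σ-truncate B (B ℕ.+ B) _ (ℕ.m≤m+n B B) (λ {i} B≤i _ → Σ-zero (B ℕ.+ B ∸ i) (λ {j} _ → row≈0 j B≤i)) ⟩
    Σ B (λ i → Σ (B ℕ.+ B ∸ i) (G i))
      ≈⟨ Σ-cong< B (λ i<B → Σ-truncate B _ (G _) (wide (ℕ.<⇒≤ i<B)) (λ B≤j _ → column≈0 _ B≤j)) ⟩
    Σ B (λ i → Σ B (G i)) ∎
    where
    wide : ∀ {i} → i ≤ B → B ≤ B ℕ.+ B ∸ i
    wide {i} i≤B = ℕ.≤-trans (ℕ.m≤m+n B (B ∸ i)) (ℕ.≤-reflexive (≡.sym (ℕ.+-∸-assoc B i≤B)))

  Σ²-+ : ∀ n k (f g : ℕ → ℕ → Carrier) →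
    Σ n (λ i → Σ k (λ j → f i j + g i j)) ≈ Σ n (λ i → Σ k (f i)) + Σ n (λ i → Σ k (g i))
  Σ²-+ n k f g = trans (Σ-cong n (λ i → Σ-+ k (f i) (g i))) (Σ-+ n _ _)

  χ : Bool → Carrier
  χ true  = 1#
  χ false = 0#

  χ-cong : ∀ {p q} → (T p → T q) → (T q → T p) → χ p ≈ χ q
  χ-cong {true}  {true}  _ _ = refl
  χ-cong {true}  {false} p⇒q _ = ⊥-elim (p⇒q tt)
  χ-cong {false} {true}  _ q⇒p = ⊥-elim (q⇒p tt)
  χ-cong {false} {false} _ _ = refl

  χ-∧ : ∀ p q → χ (p ∧ q) ≈ χ p * χ q
  χ-∧ true  q = sym (*-identityˡ _)
  χ-∧ false q = sym (zeroˡ _)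

  χ-guard : ∀ p {x} → (T p → x ≈ 0#) → χ p * x ≈ 0#
  χ-guard true  x≈0 = trans (*-identityˡ _) (x≈0 tt)
  χ-guard false _   = zeroˡ _

  χ-≡ᵇ : ∀ {x y x′ y′} → (x ≡.≡ y → x′ ≡.≡ y′) → (x′ ≡.≡ y′ → x ≡.≡ y) → χ (x ≡ᵇ y) ≈ χ (x′ ≡ᵇ y′)
  χ-≡ᵇ {x} {y} {x′} {y′} ⇒ ⇐ =
    χ-cong (λ t → ℕ.≡⇒≡ᵇ x′ y′ (⇒ (ℕ.≡ᵇ⇒≡ x y t))) (λ t → ℕ.≡⇒≡ᵇ x y (⇐ (ℕ.≡ᵇ⇒≡ x′ y′ t)))

  χ-+-≡ᵇ : ∀ i e n → χ (i ℕ.+ e ≡ᵇ n) ≈ χ (e ℕ.≤ᵇ n) * χ (n ∸ e ≡ᵇ i)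
  χ-+-≡ᵇ i e n with e ℕ.≤ᵇ n in eq
  ... | true  = trans (χ-≡ᵇ to from) (sym (*-identityˡ _))
    where
    e≤n : e ≤ n
    e≤n = ℕ.≤ᵇ⇒≤ e n (≡.subst T (≡.sym eq) tt)
    to : i ℕ.+ e ≡.≡ n → n ∸ e ≡.≡ i
    to i+e≡n = ≡.trans (≡.cong (_∸ e) (≡.sym i+e≡n)) (ℕ.m+n∸n≡m i e)
    from : n ∸ e ≡.≡ i → i ℕ.+ e ≡.≡ n
    from n∸e≡i = ≡.trans (≡.cong (ℕ._+ e) (≡.sym n∸e≡i)) (ℕ.m∸n+n≡m e≤n)
  ... | false = trans (χ-cong impossible (λ ())) (sym (zeroˡ _))
    where
    impossible : T (i ℕ.+ e ≡ᵇ n) → T false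
    impossible t = ≡.subst T eq (ℕ.≤⇒≤ᵇ (ℕ.≤-trans (ℕ.m≤n+m e i) (ℕ.≤-reflexive (ℕ.≡ᵇ⇒≡ _ _ t))))

  Σ-pick : ∀ n j (f : ℕ → Carrier) → (n ≤ j → f j ≈ 0#) → Σ n (λ i → χ (j ≡ᵇ i) * f i) ≈ f j
  Σ-pick zero    j       f out = sym (out z≤n)
  Σ-pick (suc n) zero    f _   = trans (+-cong (*-identityˡ _) (Σ-zero n (λ _ → zeroˡ _))) (+-identityʳ _)
  Σ-pick (suc n) (suc j) f out =
    trans (+-cong (zeroˡ _) (Σ-pick n j (λ i → f (suc i)) (λ n≤j → out (s≤s n≤j)))) (+-identityˡ _)

  Σ-convolve-deltas : ∀ M x y → Σ (suc M) (λ j → χ (x ≡ᵇ j) * χ (y ≡ᵇ M ∸ j)) ≈ χ (x ℕ.+ y ≡ᵇ M)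
  Σ-convolve-deltas M       zero    y = trans (+-cong (*-identityˡ _) (Σ-zero M (λ _ → zeroˡ _))) (+-identityʳ _)
  Σ-convolve-deltas zero    (suc x) y = trans (+-identityʳ _) (zeroˡ _)
  Σ-convolve-deltas (suc M) (suc x) y = trans (+-cong (zeroˡ _) (Σ-convolve-deltas M x y)) (+-identityˡ _)

  open import Algebra.Properties.CommutativeSemigroup +-commutativeSemigroup
    using (interchange; x∙yz≈y∙xz)

  S : ℕ → (List Step → Carrier) → Carrier
  S zero    F = F []
  S (suc L) F = S L (λ w → F (H ∷ w)) + (S L (λ w → F (U ∷ w)) + S L (λ w → F (D ∷ w)))

  S-cong : ∀ L {F G : List Step → Carrier} → (∀ w → F w ≈ G w) → S L F ≈ S L G
  S-cong zero    F≈G = F≈G []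
  S-cong (suc L) F≈G = +-cong (S-cong L (λ w → F≈G _)) (+-cong (S-cong L (λ w → F≈G _)) (S-cong L (λ w → F≈G _)))

  S-zero : ∀ L {F : List Step → Carrier} → (∀ w → length w ≡.≡ L → F w ≈ 0#) → S L F ≈ 0#
  S-zero zero    F≈0 = F≈0 [] ≡.refl
  S-zero (suc L) F≈0 = trans (+-cong (S-zero L (λ w e → F≈0 _ (≡.cong suc e)))
                             (+-cong (S-zero L (λ w e → F≈0 _ (≡.cong suc e))) (S-zero L (λ w e → F≈0 _ (≡.cong suc e)))))
                             (trans (+-identityˡ _) (+-identityˡ 0#))

  S-+ : ∀ L (F G : List Step → Carrier) → S L (λ w → F w + G w) ≈ S L F + S L G
  S-+ zero    F G = refl
  S-+ (suc L) F G = trans (+-cong (S-+ L _ _) (+-cong (S-+ L _ _) (S-+ L _ _)))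
                          (trans (+-congˡ (interchange _ _ _ _)) (interchange _ _ _ _))

  S-*ˡ : ∀ L x (F : List Step → Carrier) → x * S L F ≈ S L (λ w → x * F w)
  S-*ˡ zero    x F = refl
  S-*ˡ (suc L) x F = trans (distribˡ x _ _) (+-cong (S-*ˡ L x _) (trans (distribˡ x _ _) (+-cong (S-*ˡ L x _) (S-*ˡ L x _))))

  S-*ʳ : ∀ L x (F : List Step → Carrier) → S L F * x ≈ S L (λ w → F w * x)
  S-*ʳ L x F = trans (*-comm _ x) (trans (S-*ˡ L x F) (S-cong L (λ w → *-comm x (F w))))

  S-Σ : ∀ L n (G : ℕ → List Step → Carrier) → S L (λ w → Σ n (λ j → G j w)) ≈ Σ n (λ j → S L (G j))
  S-Σ zero    n G = refl
  S-Σ (suc L) n G = trans (+-cong (S-Σ L n _) (+-cong (S-Σ L n _) (S-Σ L n _)))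
                          (sym (trans (Σ-+ n _ _) (+-congˡ (Σ-+ n _ _))))

  ringSum-++ : ∀ {A : Set} (F : A → Carrier) xs ys →
    ringSum R (map F (xs ++ ys)) ≈ ringSum R (map F xs) + ringSum R (map F ys)
  ringSum-++ F []       ys = sym (+-identityˡ _)
  ringSum-++ F (x ∷ xs) ys = trans (+-congˡ (ringSum-++ F xs ys)) (sym (+-assoc _ _ _))

  ringSum-concatMap : ∀ {A B : Set} (F : B → Carrier) (g : A → List B) xs →
    ringSum R (map F (concatMap g xs)) ≈ ringSum R (map (λ x → ringSum R (map F (g x))) xs)
  ringSum-concatMap F g []       = refl
  ringSum-concatMap F g (x ∷ xs) = trans (ringSum-++ F (g x) _) (+-congˡ (ringSum-concatMap F g xs))

  ringSum-filter : ∀ {A : Set} (P : A → Bool) (F : A → Carrier) xs →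
    ringSum R (map F (filterB P xs)) ≈ ringSum R (map (λ x → χ (P x) * F x) xs)
  ringSum-filter P F []       = refl
  ringSum-filter P F (x ∷ xs) with P x
  ... | true  = +-cong (sym (*-identityˡ _)) (ringSum-filter P F xs)
  ... | false = trans (ringSum-filter P F xs) (sym (trans (+-congʳ (zeroˡ _)) (+-identityˡ _)))

  ringSum-applyUpTo : ∀ (F : ℕ → Carrier) (f : ℕ → ℕ) n → ringSum R (map F (applyUpTo f n)) ≈ Σ n (λ i → F (f i))
  ringSum-applyUpTo F f zero    = refl
  ringSum-applyUpTo F f (suc n) = +-congˡ (ringSum-applyUpTo F (λ i → f (suc i)) n)

  ringSum-words : ∀ L (F : List Step → Carrier) → ringSum R (map F (words L)) ≈ S L F
  ringSum-words zero    F = +-identityʳ _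
  ringSum-words (suc L) F = begin
    ringSum R (map F (concatMap (λ s → map (s ∷_) (words L)) (H ∷ U ∷ D ∷ [])))
      ≈⟨ ringSum-concatMap F (λ s → map (s ∷_) (words L)) (H ∷ U ∷ D ∷ []) ⟩
    part H + (part U + (part D + 0#))
      ≈⟨ +-cong (ringSum-words′ H) (+-cong (ringSum-words′ U) (trans (+-identityʳ _) (ringSum-words′ D))) ⟩
    S (suc L) F ∎
    where
    part : Step → Carrier
    part s = ringSum R (map F (map (s ∷_) (words L)))
    ringSum-words′ : ∀ s → part s ≈ S L (λ w → F (s ∷ w))
    ringSum-words′ s = trans (reflexive (≡.cong (ringSum R) (≡.sym (map-∘ (words L))))) (ringSum-words L (λ w → F (s ∷ w)))

  open import Algebra.Properties.Monoid.Mult +-monoid using (×-homo-+) renaming (_×_ to _×′_)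

  fromℕ≡× : ∀ n → fromℕ R n ≡.≡ n ×′ 1#
  fromℕ≡× zero    = ≡.refl
  fromℕ≡× (suc n) = ≡.cong (1# +_) (fromℕ≡× n)

  fromℕ-+ : ∀ x y → fromℕ R (x ℕ.+ y) ≈ fromℕ R x + fromℕ R y
  fromℕ-+ x y = begin
    fromℕ R (x ℕ.+ y)        ≡⟨ fromℕ≡× (x ℕ.+ y) ⟩
    (x ℕ.+ y) ×′ 1#           ≈⟨ ×-homo-+ 1# x y ⟩
    x ×′ 1# + y ×′ 1#          ≡⟨ ≡.cong₂ _+_ (fromℕ≡× x) (fromℕ≡× y) ⟨
    fromℕ R x + fromℕ R y    ∎

  fromℕ-if : ∀ g x → fromℕ R (if g then x else 0) ≈ χ g * fromℕ R x
  fromℕ-if true  x = sym (*-identityˡ _)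
  fromℕ-if false x = sym (zeroˡ _)

  pairSum : ℕ → (List Step → List Step → Carrier) → Carrier
  pairSum B G = Σ B (λ L₁ → Σ B (λ L₂ → S L₁ (λ u → S L₂ (G u))))

  pairSum-cong : ∀ B {G G′ : List Step → List Step → Carrier} → (∀ u v → G u v ≈ G′ u v) → pairSum B G ≈ pairSum B G′
  pairSum-cong B G≈G′ = Σ-cong B (λ L₁ → Σ-cong B (λ L₂ → S-cong L₁ (λ u → S-cong L₂ (G≈G′ u))))

  pairSum-product : ∀ B (F G : List Step → Carrier) →
    Σ B (λ L → S L F) * Σ B (λ L → S L G) ≈ pairSum B (λ u v → F u * G v)
  pairSum-product B F G = begin
    Σ B (λ L → S L F) * Σ B (λ L → S L G)                     ≈⟨ Σ-*ʳ B _ _ ⟩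
    Σ B (λ L₁ → S L₁ F * Σ B (λ L → S L G))                   ≈⟨ Σ-cong B (λ L₁ → Σ-*ˡ B _ _) ⟩
    Σ B (λ L₁ → Σ B (λ L₂ → S L₁ F * S L₂ G))                 ≈⟨ Σ-cong B (λ L₁ → Σ-cong B (λ L₂ → S-*ʳ L₁ _ F)) ⟩
    Σ B (λ L₁ → Σ B (λ L₂ → S L₁ (λ u → F u * S L₂ G)))       ≈⟨ Σ-cong B (λ L₁ → Σ-cong B (λ L₂ → S-cong L₁ (λ u → S-*ˡ L₂ (F u) G))) ⟩
    pairSum B (λ u v → F u * G v)                             ∎

  pairSum-Σ : ∀ B n (G : ℕ → List Step → List Step → Carrier) →
    Σ n (λ j → pairSum B (G j)) ≈ pairSum B (λ u v → Σ n (λ j → G j u v))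
  pairSum-Σ B n G = begin
    Σ n (λ j → Σ B (λ L₁ → Σ B (λ L₂ → S L₁ (λ u → S L₂ (G j u)))))
      ≈⟨ Σ-swap n B _ ⟩
    Σ B (λ L₁ → Σ n (λ j → Σ B (λ L₂ → S L₁ (λ u → S L₂ (G j u)))))
      ≈⟨ Σ-cong B (λ L₁ → Σ-swap n B _) ⟩
    Σ B (λ L₁ → Σ B (λ L₂ → Σ n (λ j → S L₁ (λ u → S L₂ (G j u)))))
      ≈⟨ Σ-cong B (λ L₁ → Σ-cong B (λ L₂ → S-Σ L₁ n _)) ⟨
    Σ B (λ L₁ → Σ B (λ L₂ → S L₁ (λ u → Σ n (λ j → S L₂ (G j u)))))
      ≈⟨ Σ-cong B (λ L₁ → Σ-cong B (λ L₂ → S-cong L₁ (λ u → S-Σ L₂ n (λ j → G j u)))) ⟨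
    pairSum B (λ u v → Σ n (λ j → G j u v)) ∎

  pairSum-*ˡ : ∀ B x (G : List Step → List Step → Carrier) → x * pairSum B G ≈ pairSum B (λ u v → x * G u v)
  pairSum-*ˡ B x G =
    trans (Σ-*ˡ B x _) (Σ-cong B (λ L₁ → trans (Σ-*ˡ B x _) (Σ-cong B (λ L₂ →
      trans (S-*ˡ L₁ x _) (S-cong L₁ (λ u → S-*ˡ L₂ x (G u)))))))

  returnSum : ℕ → (List Step → Carrier) → ℕ → ℕ → Carrier
  returnSum g φ L₁ L₂ = S L₁ (λ u → S L₂ (λ v → χ (validFrom g u) * (χ (validFrom 0 v) * φ (u ++ D ∷ v))))

  -- First-return decomposition: a path from height g+1 to the axis splits
  -- uniquely at its first visit to the axis as u ++ D ∷ v, where u (lowered by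
  -- one) leads from height g to 0 and v leads from the axis back to it.
  FirstReturn : ℕ → Set (c Level.⊔ ℓ)
  FirstReturn L = ∀ g (φ : List Step → Carrier) →
    S L (λ w → χ (validFrom (suc g) w) * φ w) ≈ Σ L (λ L₁ → returnSum g φ L₁ (L ∸ suc L₁))

  first-return-step : ∀ L → FirstReturn L → FirstReturn (suc L)
  first-return-step L first-return-L g φ = begin
    S L (λ w → χ (validFrom (suc g) w) * φ (H ∷ w))
      + (S L (λ w → χ (validFrom (suc (suc g)) w) * φ (U ∷ w)) + S L (λ w → χ (validFrom g w) * φ (D ∷ w)))
      ≈⟨ +-cong (first-return-L g (λ w → φ (H ∷ w))) (+-cong (first-return-L (suc g) (λ w → φ (U ∷ w))) (down g φ)) ⟩
    ΣA + (ΣB + (returnSum g φ 0 L + ΣC))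
      ≈⟨ trans (+-congˡ (x∙yz≈y∙xz _ _ _)) (x∙yz≈y∙xz _ _ _) ⟩
    returnSum g φ 0 L + (ΣA + (ΣB + ΣC))
      ≈⟨ +-congˡ (sym (trans (Σ-+ L _ _) (+-congˡ (Σ-+ L _ _)))) ⟩
    returnSum g φ 0 L + Σ L (λ L₁ → A L₁ + (B L₁ + C L₁))
      ≈⟨ +-congˡ (Σ-cong L (λ L₁ → +-cong (S-cong L₁ (λ u → S-cong (L ∸ suc L₁) (λ v → *-congʳ (χ-≡ (validFrom-H g u)))))
                                         (+-congʳ (S-cong L₁ (λ u → S-cong (L ∸ suc L₁) (λ v → *-congʳ (χ-≡ (validFrom-U g u))))))))
          ⟨
    Σ (suc L) (λ L₁ → returnSum g φ L₁ (suc L ∸ suc L₁)) ∎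
    where
    χ-≡ : ∀ {p q} → p ≡.≡ q → χ p ≈ χ q
    χ-≡ p≡q = reflexive (≡.cong χ p≡q)
    A B C : ℕ → Carrier
    A L₁ = returnSum g (λ w → φ (H ∷ w)) L₁ (L ∸ suc L₁)
    B L₁ = returnSum (suc g) (λ w → φ (U ∷ w)) L₁ (L ∸ suc L₁)
    C L₁ = S L₁ (λ u → S (L ∸ suc L₁) (λ v → χ (validFrom g (D ∷ u)) * (χ (validFrom 0 v) * φ (D ∷ u ++ D ∷ v))))
    ΣA ΣB ΣC : Carrier
    ΣA = Σ L A
    ΣB = Σ L B
    ΣC = Σ L C
    -- an initial D-step is the first visit to the axis (g = 0, u = []) or
    -- belongs to u, which is then decomposed from height g-1
    down : ∀ g φ → S L (λ w → χ (validFrom g w) * φ (D ∷ w))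
                   ≈ returnSum g φ 0 L + Σ L (λ L₁ → S L₁ (λ u → S (L ∸ suc L₁) (λ v →
                       χ (validFrom g (D ∷ u)) * (χ (validFrom 0 v) * φ (D ∷ u ++ D ∷ v)))))
    down zero    φ = sym (trans (+-cong (S-cong L (λ v → *-identityˡ _))
                                        (Σ-zero L (λ {L₁} _ → S-zero L₁ (λ u _ → S-zero (L ∸ suc L₁) (λ v _ → zeroˡ _)))))
                                (+-identityʳ _))
    down (suc g) φ = trans (first-return-L g (λ w → φ (D ∷ w)))
                           (sym (trans (+-congʳ (S-zero L {λ v → 0# * (χ (validFrom 0 v) * φ (D ∷ v))} (λ v _ → zeroˡ _)))
                                       (+-identityˡ _)))

  first-return : ∀ L → FirstReturn L
  first-return zero    g φ = zeroˡ _
  first-return (suc L) = first-return-step L (first-return L)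

  -- Counting by type: Σ over the types (i, k) with i < ri, k < rk of the number
  -- of paths of length L from height h with i H-steps and k U-steps, weighted
  -- by Ψ i k e where e = h + k is their number of D-steps.
  typeSum : ℕ → ℕ → ℕ → ℕ → (ℕ → ℕ → ℕ → Carrier) → Carrier
  typeSum ri rk L h Ψ = Σ ri (λ i → Σ rk (λ k → fromℕ R (pathCount L h i k) * Ψ i k (h ℕ.+ k)))

  typeSum-empty : ∀ ri rk h Ψ → χ (validFrom h []) * Ψ 0 0 0 ≈ typeSum (suc ri) (suc rk) 0 h Ψ
  typeSum-empty ri rk h Ψ = sym (begin
    typeSum (suc ri) (suc rk) 0 h Ψ
      ≈⟨ +-cong (+-congˡ (Σ-zero rk (λ _ → zeroˡ _)))
                (Σ-zero ri (λ {i} _ → Σ-zero (suc rk) {λ k → 0# * Ψ (suc i) k (h ℕ.+ k)} (λ _ → zeroˡ _))) ⟩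
    (fromℕ R (pathCount 0 h 0 0) * Ψ 0 0 (h ℕ.+ 0) + 0#) + 0#
      ≈⟨ trans (+-identityʳ _) (+-identityʳ _) ⟩
    fromℕ R (pathCount 0 h 0 0) * Ψ 0 0 (h ℕ.+ 0)
      ≈⟨ empty h ⟩
    χ (validFrom h []) * Ψ 0 0 0 ∎)
    where
    empty : ∀ h → fromℕ R (pathCount 0 h 0 0) * Ψ 0 0 (h ℕ.+ 0) ≈ χ (validFrom h []) * Ψ 0 0 0
    empty zero    = *-congʳ (+-identityʳ 1#)
    empty (suc h) = trans (zeroˡ _) (sym (zeroˡ _))

  typeSum-step : ∀ ri rk L h Ψ →
    typeSum (suc ri) (suc rk) (suc L) h Ψ
      ≈ typeSum ri (suc rk) L h (λ i → Ψ (suc i))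
        + (typeSum (suc ri) rk L (suc h) (λ i k → Ψ i (suc k))
           + Σ (suc ri) (λ i → Σ (suc rk) (λ k → fromℕ R (shifted (λ h′ → pathCount L h′ i k) h) * Ψ i k (h ℕ.+ k))))
  typeSum-step ri rk L h Ψ = begin
    Σ (suc ri) (λ i → Σ (suc rk) (λ k → fromℕ R (pathCount (suc L) h i k) * Ψ i k (h ℕ.+ k)))
      ≈⟨ Σ-cong (suc ri) (λ i → Σ-cong (suc rk) (λ k → split i k)) ⟩
    Σ (suc ri) (λ i → Σ (suc rk) (λ k → tH i k + (tU i k + tD i k)))
      ≈⟨ trans (Σ²-+ (suc ri) (suc rk) tH (λ i k → tU i k + tD i k)) (+-congˡ (Σ²-+ (suc ri) (suc rk) tU tD)) ⟩
    Σ (suc ri) (λ i → Σ (suc rk) (tH i)) + (Σ (suc ri) (λ i → Σ (suc rk) (tU i)) + Σ (suc ri) (λ i → Σ (suc rk) (tD i)))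
      ≈⟨ +-cong (+-identityˡ′ (Σ-zero (suc rk) {tH 0} (λ _ → zeroˡ _)))
                (+-congʳ (Σ-cong (suc ri) {λ i → Σ (suc rk) (tU i)} (λ i → +-identityˡ′ (zeroˡ _)))) ⟩
    Σ ri (λ i → Σ (suc rk) (tH (suc i))) + (Σ (suc ri) (λ i → Σ rk (λ k → tU i (suc k))) + Σ (suc ri) (λ i → Σ (suc rk) (tD i)))
      ≈⟨ +-congˡ (+-congʳ (Σ-cong (suc ri) {λ i → Σ rk (λ k → tU i (suc k))} (λ i → Σ-cong rk (λ k →
           *-congˡ (reflexive (≡.cong (Ψ i (suc k)) (ℕ.+-suc h k))))))) ⟩
    typeSum ri (suc rk) L h (λ i → Ψ (suc i))
      + (typeSum (suc ri) rk L (suc h) (λ i k → Ψ i (suc k)) + Σ (suc ri) (λ i → Σ (suc rk) (tD i))) ∎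
    where
    countH countU countD : ℕ → ℕ → ℕ
    countH i k = shifted (λ i′ → pathCount L h i′ k) i
    countU i k = shifted (pathCount L (suc h) i) k
    countD i k = shifted (λ h′ → pathCount L h′ i k) h
    tH tU tD : ℕ → ℕ → Carrier
    tH i k = fromℕ R (countH i k) * Ψ i k (h ℕ.+ k)
    tU i k = fromℕ R (countU i k) * Ψ i k (h ℕ.+ k)
    tD i k = fromℕ R (countD i k) * Ψ i k (h ℕ.+ k)
    split : ∀ i k → fromℕ R (pathCount (suc L) h i k) * Ψ i k (h ℕ.+ k) ≈ tH i k + (tU i k + tD i k)
    split i k = begin
      fromℕ R (pathCount (suc L) h i k) * Ψ i k (h ℕ.+ k)
        ≈⟨ *-congʳ (reflexive (≡.cong (fromℕ R) (pathCount-step L h i k))) ⟩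
      fromℕ R (countH i k ℕ.+ (countU i k ℕ.+ countD i k)) * Ψ i k (h ℕ.+ k)
        ≈⟨ *-congʳ (trans (fromℕ-+ (countH i k) _) (+-congˡ (fromℕ-+ (countU i k) (countD i k)))) ⟩
      (fromℕ R (countH i k) + (fromℕ R (countU i k) + fromℕ R (countD i k))) * Ψ i k (h ℕ.+ k)
        ≈⟨ trans (distribʳ _ _ _) (+-congˡ (distribʳ _ _ _)) ⟩
      tH i k + (tU i k + tD i k) ∎
    +-identityˡ′ : ∀ {x y} → x ≈ 0# → x + y ≈ y
    +-identityˡ′ x≈0 = trans (+-congʳ x≈0) (+-identityˡ _)

  S-by-type : ∀ L h ri rk (Ψ : ℕ → ℕ → ℕ → Carrier) → L < ri → L < rk →
    S L (λ w → χ (validFrom h w) * Ψ (#H w) (#U w) (#D w)) ≈ typeSum ri rk L h Ψ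
  S-by-type zero    h (suc ri) (suc rk) Ψ _ _ = typeSum-empty ri rk h Ψ
  S-by-type (suc L) h (suc ri) (suc rk) Ψ (s≤s L<ri) (s≤s L<rk) = begin
    S L (λ w → χ (validFrom h (H ∷ w)) * Ψ (suc (#H w)) (#U w) (#D w))
      + (S L (λ w → χ (validFrom h (U ∷ w)) * Ψ (#H w) (suc (#U w)) (#D w))
      + S L (λ w → χ (validFrom h (D ∷ w)) * Ψ (#H w) (#U w) (suc (#D w))))
      ≈⟨ +-cong (trans (S-cong L (λ w → *-congʳ (reflexive (≡.cong χ (validFrom-H h w)))))
                       (S-by-type L h ri (suc rk) (λ i → Ψ (suc i)) L<ri (ℕ.m<n⇒m<1+n L<rk)))
                (+-cong (trans (S-cong L (λ w → *-congʳ (reflexive (≡.cong χ (validFrom-U h w)))))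
                               (S-by-type L (suc h) (suc ri) rk (λ i k → Ψ i (suc k)) (ℕ.m<n⇒m<1+n L<ri) L<rk))
                        (down h)) ⟩
    typeSum ri (suc rk) L h (λ i → Ψ (suc i))
      + (typeSum (suc ri) rk L (suc h) (λ i k → Ψ i (suc k))
         + Σ (suc ri) (λ i → Σ (suc rk) (λ k → fromℕ R (shifted (λ h′ → pathCount L h′ i k) h) * Ψ i k (h ℕ.+ k))))
      ≈⟨ typeSum-step ri rk L h Ψ ⟨
    typeSum (suc ri) (suc rk) (suc L) h Ψ ∎
    where
    down : ∀ h → S L (λ w → χ (validFrom h (D ∷ w)) * Ψ (#H w) (#U w) (suc (#D w)))
               ≈ Σ (suc ri) (λ i → Σ (suc rk) (λ k → fromℕ R (shifted (λ h′ → pathCount L h′ i k) h) * Ψ i k (h ℕ.+ k)))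
    down zero    = trans (S-zero L (λ _ _ → zeroˡ _))
                         (sym (Σ-zero (suc ri) (λ {i} _ → Σ-zero (suc rk) {λ k → 0# * Ψ i k k} (λ _ → zeroˡ _))))
    down (suc h) = S-by-type L h (suc ri) (suc rk) (λ i k e → Ψ i k (suc e)) (ℕ.m<n⇒m<1+n L<ri) (ℕ.m<n⇒m<1+n L<rk)

module LatticePaths {r ℓ : Level} (R : CommutativeRing r ℓ) (d : ℕ) (a b : CommutativeRing.Carrier R) where
  open import Data.Nat as ℕ using (zero; suc; _≤_; _<_; s≤s; _∸_; _≡ᵇ_; _<ᵇ_)
  import Data.Nat.Properties as ℕ
  open import Data.Nat.Combinatorics using (_C_)
  open import Data.Nat.DivMod using (_/_; m/n≤m; m/n*n≤m; m*n/n≡m; /-monoˡ-≤)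
  open import Data.Nat.Tactic.RingSolver using (solve-∀)
  open import Data.Bool using (Bool; true; false; T; _∧_)
  open import Data.Empty using (⊥; ⊥-elim)
  open import Data.Unit using (tt)
  open import Data.Sum using (inj₁; inj₂)
  open import Data.List using (List; []; _∷_; _++_; map; concatMap; upTo)
  open import Function using (id)
  import Relation.Binary.PropositionalEquality as ≡
  open Sequences
  open Binomials using (ballot; pathCount; dyck-count)
  open RingSums R

  open CommutativeRing R
  open import Relation.Binary.Reasoning.Setoid setoid
  open import Algebra.Solver.CommutativeMonoid *-commutativeMonoid using (solve; _⊜_; _⊕_)
  open import Algebra.Properties.CommutativeSemigroup *-commutativeSemigroup using (x∙yz≈y∙xz)

  -- m = d + 1, so that a D-step has horizontal extent d.
  m : ℕ
  m = suc d

  weight : List Step → Carrier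
  weight = pathWeight R a b

  weight-++ : ∀ u v → weight (u ++ v) ≈ weight u * weight v
  weight-++ []      v = sym (*-identityˡ _)
  weight-++ (s ∷ u) v = trans (*-congˡ (weight-++ u v)) (sym (*-assoc _ _ _))

  _⋆_ : Series R → Series R → Series R
  _⋆_ = _*S_ R

  c : ℕ → Carrier
  c = fm R m a b

  contrib : ℕ → List Step → Carrier
  contrib n w = χ (validFrom 0 w) * (χ (xlen m w ≡ᵇ n) * weight w)

  c-by-length : ∀ n → c n ≈ Σ (suc (2 ℕ.* n)) (λ L → S L (contrib n))
  c-by-length n = begin
    ringSum R (map weight (filterB P (concatMap words (upTo B))))
      ≈⟨ ringSum-filter P weight (concatMap words (upTo B)) ⟩
    ringSum R (map g (concatMap words (upTo B)))
      ≈⟨ ringSum-concatMap g words (upTo B) ⟩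
    ringSum R (map (λ L → ringSum R (map g (words L))) (upTo B))
      ≈⟨ ringSum-applyUpTo _ id B ⟩
    Σ B (λ L → ringSum R (map g (words L)))
      ≈⟨ Σ-cong B (λ L → trans (ringSum-words L g) (S-cong L (λ w → trans (*-congʳ (χ-∧ (validFrom 0 w) (xlen m w ≡ᵇ n))) (*-assoc _ _ _)))) ⟩
    Σ B (λ L → S L (contrib n)) ∎
    where
    B = suc (2 ℕ.* n)
    P : List Step → Bool
    P w = validFrom 0 w ∧ (xlen m w ≡ᵇ n)
    g : List Step → Carrier
    g w = χ (P w) * weight w

  long-sequences-vanish : ∀ n L → 2 ℕ.* n < L → S L (contrib n) ≈ 0#
  long-sequences-vanish n L 2n<L = S-zero L λ w |w|≡L →
    χ-guard (validFrom 0 w) λ valid → χ-guard (xlen m w ≡ᵇ n) λ x≡n →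
      ⊥-elim (ℕ.<⇒≱ 2n<L (≡.subst (_≤ 2 ℕ.* n) |w|≡L
        (short-path m n w valid (ℕ.≤-reflexive (ℕ.≡ᵇ⇒≡ _ _ x≡n)))))

  c-stable : ∀ n N → 2 ℕ.* n < N → Σ N (λ L → S L (contrib n)) ≈ c n
  c-stable n N 2n<N =
    trans (Σ-truncate _ N _ 2n<N (λ {L} 2n<L _ → long-sequences-vanish n L 2n<L)) (sym (c-by-length n))

  contrib-[] : ∀ n → contrib n [] ≈ oneS R n
  contrib-[] zero    = trans (*-identityˡ _) (*-identityˡ _)
  contrib-[] (suc n) = trans (*-identityˡ _) (zeroˡ _)

  down-first-vanishes : ∀ N n → Σ N (λ L → S L (λ w → contrib n (D ∷ w))) ≈ 0#
  down-first-vanishes N n = Σ-zero N (λ {L} _ → S-zero L (λ w _ → zeroˡ _))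

  horizontal-first : ∀ N n → 2 ℕ.* n < suc N → Σ N (λ L → S L (λ w → contrib n (H ∷ w))) ≈ a * zPow R 1 c n
  horizontal-first N zero    _ =
    trans (Σ-zero N (λ {L} _ → S-zero L (λ w _ → trans (*-congˡ (zeroˡ _)) (zeroʳ _)))) (sym (zeroʳ a))
  horizontal-first N (suc n) 2n+2<N+1 = begin
    Σ N (λ L → S L (λ w → contrib (suc n) (H ∷ w)))    ≈⟨ Σ-cong N (λ L → S-cong L (λ w → pull-a _ _ _)) ⟩
    Σ N (λ L → S L (λ w → a * contrib n w))             ≈⟨ Σ-cong N (λ L → S-*ˡ L a _) ⟨
    Σ N (λ L → a * S L (contrib n))                     ≈⟨ Σ-*ˡ N a _ ⟨
    a * Σ N (λ L → S L (contrib n))                     ≈⟨ *-congˡ (c-stable n N 2n<N) ⟩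
    a * c n                                             ∎
    where
    pull-a : ∀ p q w → p * (q * (a * w)) ≈ a * (p * (q * w))
    pull-a = solve 4 (λ a p q w → p ⊕ (q ⊕ (a ⊕ w)) ⊜ a ⊕ (p ⊕ (q ⊕ w))) refl a
    2n<N : 2 ℕ.* n < N
    2n<N = ℕ.<-≤-trans (ℕ.*-monoʳ-< 2 (ℕ.n<1+n n)) (ℕ.≤-pred 2n+2<N+1)

  afterUp : ℕ → List Step → Carrier
  afterUp n w = χ (suc (xlen m w) ≡ᵇ n) * weight w

  pairTerm : ℕ → List Step → List Step → Carrier
  pairTerm n u v = χ (validFrom 0 u) * (χ (validFrom 0 v) * afterUp n (u ++ D ∷ v))

  pairTerm-vanishes : ∀ n u v →
    (T (validFrom 0 u) → T (validFrom 0 v) → suc (xlen m u ℕ.+ (d ℕ.+ xlen m v)) ≡.≡ n → ⊥) → pairTerm n u v ≈ 0#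
  pairTerm-vanishes n u v impossible =
    χ-guard _ λ valid-u → χ-guard _ λ valid-v → χ-guard _ λ e →
      ⊥-elim (impossible valid-u valid-v (≡.trans (≡.cong suc (≡.sym (xlen-++ m u (D ∷ v)))) (ℕ.≡ᵇ⇒≡ _ _ e)))

  -- Both halves of a pair contributing to c(n) are paths of extent at most n.
  pairs-of-long-u-vanish : ∀ n L₁ L₂ → 2 ℕ.* n < L₁ → returnSum 0 (afterUp n) L₁ L₂ ≈ 0#
  pairs-of-long-u-vanish n L₁ L₂ 2n<L₁ = S-zero L₁ λ u |u|≡L₁ → S-zero L₂ λ v _ →
    pairTerm-vanishes n u v λ valid-u _ e → ℕ.<⇒≱ 2n<L₁ (≡.subst (_≤ 2 ℕ.* n) |u|≡L₁ (short-path m n u valid-u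
      (ℕ.≤-trans (ℕ.m≤m+n _ _) (ℕ.≤-trans (ℕ.n≤1+n _) (ℕ.≤-reflexive e)))))

  pairs-of-long-v-vanish : ∀ n L₁ L₂ → 2 ℕ.* n < L₂ → returnSum 0 (afterUp n) L₁ L₂ ≈ 0#
  pairs-of-long-v-vanish n L₁ L₂ 2n<L₂ = S-zero L₁ λ u _ → S-zero L₂ λ v |v|≡L₂ →
    pairTerm-vanishes n u v λ _ valid-v e → ℕ.<⇒≱ 2n<L₂ (≡.subst (_≤ 2 ℕ.* n) |v|≡L₂ (short-path m n v valid-v
      (ℕ.≤-trans (ℕ.m≤n+m _ d) (ℕ.≤-trans (ℕ.m≤n+m _ (xlen m u)) (ℕ.≤-trans (ℕ.n≤1+n _) (ℕ.≤-reflexive e))))))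

  -- For n < m there is no room for a U- and a D-step.
  pairs-vanish-below-m : ∀ n u v → n < m → pairTerm n u v ≈ 0#
  pairs-vanish-below-m n u v n<m = pairTerm-vanishes n u v λ _ _ e →
    ℕ.<⇒≱ n<m (≡.subst (m ≤_) e (s≤s (ℕ.≤-trans (ℕ.m≤m+n d _) (ℕ.m≤n+m _ (xlen m u)))))

  zPow-below : ∀ k (f : Series R) n → n < k → zPow R k f n ≡.≡ 0#
  zPow-below k f n n<k with n <ᵇ k in eq
  ... | true  = ≡.refl
  ... | false = ⊥-elim (≡.subst T eq (ℕ.<⇒<ᵇ n<k))

  zPow-above : ∀ k (f : Series R) n → k ≤ n → zPow R k f n ≡.≡ f (n ∸ k)
  zPow-above k f n k≤n with n <ᵇ k in eq
  ... | true  = ⊥-elim (ℕ.<⇒≱ (ℕ.<ᵇ⇒< n k (≡.subst T (≡.sym eq) _)) k≤n)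
  ... | false = ≡.refl

  private
    extent-of-pair : ∀ d x y → suc (x ℕ.+ (d ℕ.+ y)) ≡.≡ suc d ℕ.+ (x ℕ.+ y)
    extent-of-pair = solve-∀

  pair-convolution : ∀ n → m ≤ n → ∀ u v →
    b * Σ (suc (n ∸ m)) (λ j → contrib j u * contrib (n ∸ m ∸ j) v) ≈ pairTerm n u v
  pair-convolution n m≤n u v = begin
    b * Σ (suc n′) (λ j → contrib j u * contrib (n′ ∸ j) v)
      ≈⟨ *-congˡ (Σ-cong (suc n′) (λ j → regroup (χ (validFrom 0 u)) (χ (xu ≡ᵇ j)) (weight u) (χ (validFrom 0 v)) (χ (xv ≡ᵇ n′ ∸ j)) (weight v))) ⟩
    b * Σ (suc n′) (λ j → X * (δ j * W))
      ≈⟨ *-congˡ (Σ-*ˡ (suc n′) X (λ j → δ j * W)) ⟨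
    b * (X * Σ (suc n′) (λ j → δ j * W))
      ≈⟨ *-congˡ (*-congˡ (Σ-*ʳ (suc n′) W δ)) ⟨
    b * (X * (Σ (suc n′) δ * W))
      ≈⟨ *-congˡ (*-congˡ (*-congʳ (Σ-convolve-deltas n′ xu xv))) ⟩
    b * (X * (χ (xu ℕ.+ xv ≡ᵇ n′) * W))
      ≈⟨ move-b _ _ _ _ _ ⟩
    χ (validFrom 0 u) * (χ (validFrom 0 v) * (χ (xu ℕ.+ xv ≡ᵇ n′) * (weight u * (b * weight v))))
      ≈⟨ *-congˡ (*-congˡ (*-cong (χ-≡ᵇ to from) (sym (weight-++ u (D ∷ v))))) ⟩
    pairTerm n u v ∎
    where
    n′ = n ∸ m
    xu = xlen m u
    xv = xlen m v
    X = χ (validFrom 0 u) * χ (validFrom 0 v)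
    W = weight u * weight v
    δ : ℕ → Carrier
    δ j = χ (xu ≡ᵇ j) * χ (xv ≡ᵇ n′ ∸ j)
    regroup : ∀ p e w q f z → (p * (e * w)) * (q * (f * z)) ≈ (p * q) * ((e * f) * (w * z))
    regroup = solve 6 (λ p e w q f z → (p ⊕ (e ⊕ w)) ⊕ (q ⊕ (f ⊕ z)) ⊜ (p ⊕ q) ⊕ ((e ⊕ f) ⊕ (w ⊕ z))) refl
    move-b : ∀ p q g w z → b * ((p * q) * (g * (w * z))) ≈ p * (q * (g * (w * (b * z))))
    move-b = solve 6 (λ b p q g w z → b ⊕ ((p ⊕ q) ⊕ (g ⊕ (w ⊕ z))) ⊜ p ⊕ (q ⊕ (g ⊕ (w ⊕ (b ⊕ z))))) refl b
    extent : suc (xlen m (u ++ D ∷ v)) ≡.≡ m ℕ.+ (xu ℕ.+ xv)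
    extent = ≡.trans (≡.cong suc (xlen-++ m u (D ∷ v))) (extent-of-pair d xu xv)
    to : xu ℕ.+ xv ≡.≡ n′ → suc (xlen m (u ++ D ∷ v)) ≡.≡ n
    to e = ≡.trans extent (≡.trans (≡.cong (m ℕ.+_) e) (ℕ.m+[n∸m]≡n m≤n))
    from : suc (xlen m (u ++ D ∷ v)) ≡.≡ n → xu ℕ.+ xv ≡.≡ n′
    from e = ≡.trans (≡.sym (ℕ.m+n∸m≡n m _)) (≡.cong (_∸ m) (≡.trans (≡.sym extent) e))

  pairs-sum : ∀ n → pairSum (suc (2 ℕ.* n)) (pairTerm n) ≈ b * zPow R m (c ⋆ c) n
  pairs-sum n with ℕ.≤-<-connex m n
  ... | inj₂ n<m = begin
    pairSum B (pairTerm n)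
      ≈⟨ Σ-zero B (λ {L₁} _ → Σ-zero B (λ {L₂} _ → S-zero L₁ (λ u _ → S-zero L₂ (λ v _ → pairs-vanish-below-m n u v n<m)))) ⟩
    0#                                 ≈⟨ zeroʳ b ⟨
    b * 0#                             ≡⟨ ≡.cong (b *_) (zPow-below m (c ⋆ c) n n<m) ⟨
    b * zPow R m (c ⋆ c) n            ∎
    where B = suc (2 ℕ.* n)
  ... | inj₁ m≤n = begin
    pairSum B (pairTerm n)
      ≈⟨ pairSum-cong B (pair-convolution n m≤n) ⟨
    pairSum B (λ u v → b * Σ (suc n′) (λ j → contrib j u * contrib (n′ ∸ j) v))
      ≈⟨ pairSum-*ˡ B b (λ u v → Σ (suc n′) (λ j → contrib j u * contrib (n′ ∸ j) v)) ⟨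
    b * pairSum B (λ u v → Σ (suc n′) (λ j → contrib j u * contrib (n′ ∸ j) v))
      ≈⟨ *-congˡ (pairSum-Σ B (suc n′) (λ j u v → contrib j u * contrib (n′ ∸ j) v)) ⟨
    b * Σ (suc n′) (λ j → pairSum B (λ u v → contrib j u * contrib (n′ ∸ j) v))
      ≈⟨ *-congˡ (Σ-cong< (suc n′) (λ {j} j≤n′ → trans (sym (pairSum-product B (contrib j) (contrib (n′ ∸ j))))
                   (*-cong (c-stable j B (within (ℕ.≤-pred j≤n′))) (c-stable (n′ ∸ j) B (within (ℕ.m∸n≤m n′ j)))))) ⟩
    b * Σ (suc n′) (λ j → c j * c (n′ ∸ j))
      ≈⟨ *-congˡ (ringSum-applyUpTo (λ j → c j * c (n′ ∸ j)) id (suc n′)) ⟨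
    b * (c ⋆ c) n′
      ≡⟨ ≡.cong (b *_) (zPow-above m (c ⋆ c) n m≤n) ⟨
    b * zPow R m (c ⋆ c) n ∎
    where
    B = suc (2 ℕ.* n)
    n′ = n ∸ m
    within : ∀ {j} → j ≤ n′ → 2 ℕ.* j < B
    within j≤n′ = s≤s (ℕ.*-monoʳ-≤ 2 (ℕ.≤-trans j≤n′ (ℕ.m∸n≤m n m)))

  -- A path to (n,0) starting with U is U u D v with paths u, v (first return to the axis).
  up-first : ∀ n → let B = suc (2 ℕ.* n) in
    Σ (suc (B ℕ.+ B)) (λ L → S L (λ w → contrib n (U ∷ w))) ≈ b * zPow R m (c ⋆ c) n
  up-first n = begin
    Σ (suc (B ℕ.+ B)) (λ L → S L (λ w → contrib n (U ∷ w)))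
      ≈⟨ Σ-cong (suc (B ℕ.+ B)) (λ L → S-cong L (λ w → *-congˡ {χ (validFrom 1 w)} (*-congˡ {χ (suc (xlen m w) ≡ᵇ n)} (*-identityˡ (weight w))))) ⟩
    Σ (suc (B ℕ.+ B)) (λ L → S L (λ w → χ (validFrom 1 w) * afterUp n w))
      ≈⟨ Σ-cong (suc (B ℕ.+ B)) (λ L → first-return L 0 (afterUp n)) ⟩
    Σ (suc (B ℕ.+ B)) (λ L → Σ L (λ L₁ → returnSum 0 (afterUp n) L₁ (L ∸ suc L₁)))
      ≈⟨ +-identityˡ _ ⟩
    Σ (B ℕ.+ B) (λ L → Σ (suc L) (λ L₁ → returnSum 0 (afterUp n) L₁ (L ∸ L₁)))
      ≈⟨ Σ-antidiagonals (B ℕ.+ B) (returnSum 0 (afterUp n)) ⟩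
    Σ (B ℕ.+ B) (λ L₁ → Σ (B ℕ.+ B ∸ L₁) (returnSum 0 (afterUp n) L₁))
      ≈⟨ Σ-triangle-to-square B (returnSum 0 (afterUp n))
           (λ {L₁} L₂ → pairs-of-long-u-vanish n L₁ L₂) (λ L₁ {L₂} → pairs-of-long-v-vanish n L₁ L₂) ⟩
    pairSum B (pairTerm n)
      ≈⟨ pairs-sum n ⟩
    b * zPow R m (c ⋆ c) n ∎
    where B = suc (2 ℕ.* n)

  functional-equation : ∀ n → c n ≈ oneS R n + (a * zPow R 1 c n + b * zPow R m (c ⋆ c) n)
  functional-equation n = begin
    c n
      ≈⟨ c-stable n (suc N) (ℕ.≤-trans B≤N (ℕ.n≤1+n N)) ⟨
    contrib n [] + Σ N (λ L → S L (λ w → contrib n (H ∷ w)) + (S L (λ w → contrib n (U ∷ w)) + S L (λ w → contrib n (D ∷ w))))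
      ≈⟨ +-congˡ (trans (Σ-+ N (part H) (λ L → part U L + part D L)) (+-congˡ (Σ-+ N (part U) (part D)))) ⟩
    contrib n [] + (Σ N (λ L → S L (λ w → contrib n (H ∷ w)))
                     + (Σ N (λ L → S L (λ w → contrib n (U ∷ w))) + Σ N (λ L → S L (λ w → contrib n (D ∷ w)))))
      ≈⟨ +-cong (contrib-[] n) (+-cong (horizontal-first N n (ℕ.≤-trans B≤N (ℕ.n≤1+n N)))
                                       (trans (+-congʳ (up-first n)) (trans (+-congˡ (down-first-vanishes N n)) (+-identityʳ _)))) ⟩
    oneS R n + (a * zPow R 1 c n + b * zPow R m (c ⋆ c) n) ∎
    where
    B = suc (2 ℕ.* n)
    N = suc (B ℕ.+ B)
    B≤N : B ≤ N
    B≤N = ℕ.≤-trans (ℕ.m≤m+n B B) (ℕ.n≤1+n (B ℕ.+ B))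
    part : Step → ℕ → Carrier
    part s L = S L (λ w → contrib n (s ∷ w))

  weight-by-type : ∀ w → weight w ≈ pow R a (#H w) * pow R b (#D w)
  weight-by-type []      = sym (*-identityˡ 1#)
  weight-by-type (H ∷ w) = trans (*-congˡ (weight-by-type w)) (sym (*-assoc _ _ _))
  weight-by-type (U ∷ w) = trans (*-identityˡ _) (weight-by-type w)
  weight-by-type (D ∷ w) = trans (*-congˡ (weight-by-type w)) (x∙yz≈y∙xz b _ _)

  typeContrib : ℕ → ℕ → ℕ → ℕ → Carrier
  typeContrib n i k e = χ (i ℕ.+ (k ℕ.+ d ℕ.* e) ≡ᵇ n) * (pow R a i * pow R b e)

  contrib-by-type : ∀ n w → contrib n w ≈ χ (validFrom 0 w) * typeContrib n (#H w) (#U w) (#D w)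
  contrib-by-type n w =
    *-congˡ (*-cong (reflexive (≡.cong (λ x → χ (x ≡ᵇ n)) (xlen-by-type d w))) (weight-by-type w))

  private
    dyck-length : ∀ d i k → 2 ℕ.* (i ℕ.+ (k ℕ.+ d ℕ.* k)) ≡.≡ (i ℕ.+ 2 ℕ.* k ℕ.+ 0) ℕ.+ (i ℕ.+ 2 ℕ.* (d ℕ.* k))
    dyck-length = solve-∀

  -- Summing over lengths: a path with i H-steps and k U/D-pairs has length i + 2k.
  sum-over-lengths : ∀ n i k B → 2 ℕ.* n < B →
    Σ B (λ L → fromℕ R (pathCount L 0 i k) * typeContrib n i k k)
      ≈ fromℕ R (((i ℕ.+ 2 ℕ.* k ℕ.+ 0) C i) ℕ.* ballot k 0) * typeContrib n i k k
  sum-over-lengths n i k B 2n<B = begin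
    Σ B (λ L → fromℕ R (pathCount L 0 i k) * typeContrib n i k k)
      ≈⟨ Σ-cong B (λ L → trans (*-congʳ (fromℕ-if (len ≡ᵇ L) ((L C i) ℕ.* ballot k 0))) (*-assoc _ _ _)) ⟩
    Σ B (λ L → χ (len ≡ᵇ L) * (fromℕ R ((L C i) ℕ.* ballot k 0) * typeContrib n i k k))
      ≈⟨ Σ-pick B len (λ L → fromℕ R ((L C i) ℕ.* ballot k 0) * typeContrib n i k k) too-long ⟩
    fromℕ R ((len C i) ℕ.* ballot k 0) * typeContrib n i k k ∎
    where
    len = i ℕ.+ 2 ℕ.* k ℕ.+ 0
    bounded : i ℕ.+ (k ℕ.+ d ℕ.* k) ≡.≡ n → len ≤ 2 ℕ.* n
    bounded e = ℕ.≤-trans (ℕ.m≤m+n len (i ℕ.+ 2 ℕ.* (d ℕ.* k)))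
                          (ℕ.≤-reflexive (≡.trans (≡.sym (dyck-length d i k)) (≡.cong (2 ℕ.*_) e)))
    too-long : B ≤ len → fromℕ R ((len C i) ℕ.* ballot k 0) * typeContrib n i k k ≈ 0#
    too-long B≤len = trans (*-congˡ (χ-guard (i ℕ.+ (k ℕ.+ d ℕ.* k) ≡ᵇ n) λ e →
      ⊥-elim (ℕ.<⇒≱ (ℕ.<-≤-trans 2n<B B≤len) (bounded (ℕ.≡ᵇ⇒≡ _ _ e))))) (zeroʳ _)

  -- Summing over the number i of H-steps: i = n - m k.
  sum-over-H : ∀ n k B (F : ℕ → Carrier) → n < B →
    Σ B (λ i → F i * typeContrib n i k k)
      ≈ χ (m ℕ.* k ℕ.≤ᵇ n) * (F (n ∸ m ℕ.* k) * (pow R a (n ∸ m ℕ.* k) * pow R b k))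
  sum-over-H n k B F n<B = begin
    Σ B (λ i → F i * typeContrib n i k k)
      ≈⟨ Σ-cong B (λ i → trans (*-congˡ (*-congʳ (χ-+-≡ᵇ i (m ℕ.* k) n))) (regroup _ _ _ _)) ⟩
    Σ B (λ i → χ (m ℕ.* k ℕ.≤ᵇ n) * (χ (n ∸ m ℕ.* k ≡ᵇ i) * (F i * (pow R a i * pow R b k))))
      ≈⟨ Σ-*ˡ B _ _ ⟨
    χ (m ℕ.* k ℕ.≤ᵇ n) * Σ B (λ i → χ (n ∸ m ℕ.* k ≡ᵇ i) * (F i * (pow R a i * pow R b k)))
      ≈⟨ *-congˡ (Σ-pick B (n ∸ m ℕ.* k) _ (λ B≤ → ⊥-elim (ℕ.<⇒≱ (ℕ.≤-<-trans (ℕ.m∸n≤m n (m ℕ.* k)) n<B) B≤))) ⟩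
    χ (m ℕ.* k ℕ.≤ᵇ n) * (F (n ∸ m ℕ.* k) * (pow R a (n ∸ m ℕ.* k) * pow R b k)) ∎
    where
    regroup : ∀ f p q x → f * ((p * q) * x) ≈ p * (q * (f * x))
    regroup = solve 4 (λ f p q x → f ⊕ ((p ⊕ q) ⊕ x) ⊜ p ⊕ (q ⊕ (f ⊕ x))) refl

  -- Summing over the number k of U-steps: m k ≤ n, i.e. k ≤ n/m.
  sum-over-U : ∀ n B (V : ℕ → Carrier) → n < B → Σ B (λ k → χ (m ℕ.* k ℕ.≤ᵇ n) * V k) ≈ Σ (suc (n / m)) V
  sum-over-U n B V n<B = begin
    Σ B (λ k → χ (m ℕ.* k ℕ.≤ᵇ n) * V k)
      ≈⟨ Σ-truncate (suc (n / m)) B _ (ℕ.≤-<-trans (m/n≤m n m) n<B) (λ n/m<k _ → beyond n/m<k) ⟩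
    Σ (suc (n / m)) (λ k → χ (m ℕ.* k ℕ.≤ᵇ n) * V k)
      ≈⟨ Σ-cong< (suc (n / m)) {λ k → χ (m ℕ.* k ℕ.≤ᵇ n) * V k} (λ k≤n/m → within (ℕ.≤-pred k≤n/m)) ⟩
    Σ (suc (n / m)) V ∎
    where
    below : ∀ {k} → m ℕ.* k ≤ n → k ≤ n / m
    below {k} mk≤n = ℕ.≤-trans (ℕ.≤-reflexive (≡.sym (m*n/n≡m k m))) (/-monoˡ-≤ m (ℕ.≤-trans (ℕ.≤-reflexive (ℕ.*-comm k m)) mk≤n))
    above : ∀ {k} → k ≤ n / m → m ℕ.* k ≤ n
    above {k} k≤n/m = ℕ.≤-trans (ℕ.≤-reflexive (ℕ.*-comm m k)) (ℕ.≤-trans (ℕ.*-monoˡ-≤ m k≤n/m) (m/n*n≤m n m))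
    beyond : ∀ {k} → n / m < k → χ (m ℕ.* k ℕ.≤ᵇ n) * V k ≈ 0#
    beyond n/m<k = χ-guard _ (λ t → ⊥-elim (ℕ.<⇒≱ n/m<k (below (ℕ.≤ᵇ⇒≤ _ _ t))))
    within : ∀ {k} → k ≤ n / m → χ (m ℕ.* k ℕ.≤ᵇ n) * V k ≈ V k
    within k≤n/m = trans (*-congʳ (χ-cong (λ _ → tt) (λ _ → ℕ.≤⇒≤ᵇ (above k≤n/m)))) (*-identityˡ _)

  closed-formula : ∀ n → c n ≈ closedForm R n m a b
  closed-formula n = begin
    c n
      ≈⟨ c-by-length n ⟩
    Σ B (λ L → S L (contrib n))
      ≈⟨ Σ-cong< B (λ {L} L<B → trans (S-cong L (contrib-by-type n)) (S-by-type L 0 B B (typeContrib n) L<B L<B)) ⟩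
    Σ B (λ L → Σ B (λ i → Σ B (λ k → term L i k)))
      ≈⟨ trans (Σ-swap B B (λ L i → Σ B (term L i))) (Σ-cong B (λ i → Σ-swap B B (λ L k → term L i k))) ⟩
    Σ B (λ i → Σ B (λ k → Σ B (λ L → term L i k)))
      ≈⟨ Σ-cong B (λ i → Σ-cong B (λ k → sum-over-lengths n i k B ℕ.≤-refl)) ⟩
    Σ B (λ i → Σ B (λ k → fromℕ R (coefficient i k) * typeContrib n i k k))
      ≈⟨ Σ-swap B B (λ i k → fromℕ R (coefficient i k) * typeContrib n i k k) ⟩
    Σ B (λ k → Σ B (λ i → fromℕ R (coefficient i k) * typeContrib n i k k))
      ≈⟨ Σ-cong B (λ k → sum-over-H n k B (λ i → fromℕ R (coefficient i k)) n<B) ⟩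
    Σ B (λ k → χ (m ℕ.* k ℕ.≤ᵇ n) * V k)
      ≈⟨ sum-over-U n B V n<B ⟩
    Σ (suc (n / m)) V
      ≈⟨ Σ-cong (suc (n / m)) {V} (λ k → *-congʳ (reflexive (≡.cong (fromℕ R) (dyck-count (n ∸ m ℕ.* k) k)))) ⟩
    Σ (suc (n / m)) (λ k → fromℕ R (catalan k ℕ.* ((n ∸ m ℕ.* k ℕ.+ 2 ℕ.* k) C (2 ℕ.* k)))
                           * (pow R a (n ∸ m ℕ.* k) * pow R b k))
      ≈⟨ ringSum-applyUpTo _ id (suc (n / m)) ⟨
    closedForm R n m a b ∎
    where
    B = suc (2 ℕ.* n)
    n<B : n < B
    n<B = s≤s (ℕ.m≤n*m n 2)
    term : ℕ → ℕ → ℕ → Carrier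
    term L i k = fromℕ R (pathCount L 0 i k) * typeContrib n i k k
    coefficient : ℕ → ℕ → ℕ
    coefficient i k = ((i ℕ.+ 2 ℕ.* k ℕ.+ 0) C i) ℕ.* ballot k 0
    V : ℕ → Carrier
    V k = fromℕ R (coefficient (n ∸ m ℕ.* k) k) * (pow R a (n ∸ m ℕ.* k) * pow R b k)

open import Data.Nat using (zero; suc; ≢-nonZero⁻¹)
open import Data.Product using (_,_)
open import Data.Empty using (⊥-elim)
open import Relation.Binary.PropositionalEquality using (refl)

lemma3p2 : {c ℓ : Level} (R : CommutativeRing c ℓ) (m : ℕ) → .{{_ : NonZero m}} → (a b : CommutativeRing.Carrier R) →
    ((n : ℕ) → CommutativeRing._≈_ R (fm R m a b n)
        (_+S_ R (oneS R) (_+S_ R (_·S_ R a (zPow R 1 (fm R m a b))) (_·S_ R b (zPow R m (_*S_ R (fm R m a b) (fm R m a b))))) n))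
    × ((n : ℕ) → CommutativeRing._≈_ R (cnm R n m a b) (closedForm R n m a b))
lemma3p2 R zero    a b = ⊥-elim (≢-nonZero⁻¹ 0 refl)
lemma3p2 R (suc d) a b = functional-equation , closed-formula
  where open LatticePaths R d a b
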